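{- For every constant specification $\mathcal{CS}$ for $\mathsf{J4}(\mathsf{FP})$, the logic $\mathsf{J4}(\mathsf{FP})_{\mathcal{CS}}$ is consistent.
   Context: $\mathsf{J4}$ is the justification logic with terms built from justification variables and constants by binary $\cdot$, $+$ and unary $!$; formulas $A::= p\mid\bot\mid\neg A\mid A\wedge A\mid A\vee A\mid A\rightarrow A\mid t:A$; axioms: all propositional tautologies, $s:A\rightarrow(s+t):A$, $s:A\rightarrow(t+s):A$, $s:(A\rightarrow B)\rightarrow(t:A\rightarrow(s\cdot t):B)$, $t:A\rightarrow !t:t:A$; rules Modus Ponens and Iterated Axiom Necessitation: $\vdash c_{i_n}:\dots:c_{i_1}:A$ for an axiom instance $A$, constants $c_{i_j}$, $n\ge1$. $\mathsf{J4}(\mathsf{FP})$ extends the language by an $n$-ary operator $\delta_A$ for each formula $A(p,q_1,\dots,q_n)$ in which every occurrence of $p$ lies in the scope of some $t:$, and adds the axioms $\delta_A(B_1,\dots,B_n)\leftrightarrow A(\delta_A(B_1,\dots,B_n),B_1,\dots,B_n)$ for all formulas $B_i$ of the extended language. A constant specification $\mathcal{CS}$ is a set of formulas $c_{i_n}:\dots:c_{i_1}:A$ with $A$ an axiom instance of $\mathsf{J4}(\mathsf{FP})$; $\mathsf{J4}(\mathsf{FP})_{\mathcal{CS}}$ is the logic in which Iterated Axiom Necessitation only produces members of $\mathcal{CS}$. -}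

module Defs where

open import Data.Nat using (ℕ; _≡ᵇ_)
open import Data.Bool using (Bool; true; false; _∧_; _∨_; not; if_then_else_; T)
open import Data.List using (List; []; _∷_)
open import Data.Bool.ListAction using (any)
import Data.Empty
open import Data.Vec using (Vec; []; _∷_; toList)
open import Data.Product using (Σ; _×_; _,_)
open import Relation.Binary.PropositionalEquality using (_≡_)

data Tm : Set where
  var : ℕ → Tm
  con : ℕ → Tm
  _·_ : Tm → Tm → Tm
  _⊕_ : Tm → Tm → Tm
  !_  : Tm → Tm

distinct : List ℕ → Bool
distinct []       = true
distinct (x ∷ xs) = not (any (x ≡ᵇ_) xs) ∧ distinct xs

-- Formulas of the extended language of J4(FP) (induction-recursion).
-- δ n p qs A _ _ _ Bs  is  δ_A(B_1,…,B_n)  for the formula A(p,q_1,…,q_n),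
-- where p,q_1,…,q_n are distinct propositional variables, every atom of A
-- is among them, and every occurrence of p in A is in the scope of some t:.

data Fm : Set
guarded   : ℕ → Fm → Bool
guardedV  : ∀ {n} → ℕ → Vec Fm n → Bool
atomsIn   : List ℕ → Fm → Bool
atomsInV  : ∀ {n} → List ℕ → Vec Fm n → Bool

data Fm where
  atom : ℕ → Fm
  ⊥'   : Fm
  ¬'_  : Fm → Fm
  _∧'_ : Fm → Fm → Fm
  _∨'_ : Fm → Fm → Fm
  _⇒_  : Fm → Fm → Fm
  _∶_  : Tm → Fm → Fm
  δ    : (n p : ℕ) (qs : Vec ℕ n) (A : Fm) →
         T (distinct (p ∷ toList qs)) →
         T (guarded p A) →
         T (atomsIn (p ∷ toList qs) A) →
         Vec Fm n → Fm

infixr 5 _⇒_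
infixr 6 _∨'_
infixr 7 _∧'_
infixr 9 _∶_

guarded p (atom q)         = not (q ≡ᵇ p)
guarded p ⊥'               = true
guarded p (¬' A)           = guarded p A
guarded p (A ∧' B)         = guarded p A ∧ guarded p B
guarded p (A ∨' B)         = guarded p A ∧ guarded p B
guarded p (A ⇒ B)          = guarded p A ∧ guarded p B
guarded p (t ∶ A)          = true
guarded p (δ _ _ _ _ _ _ _ Bs) = guardedV p Bs

guardedV p []       = true
guardedV p (B ∷ Bs) = guarded p B ∧ guardedV p Bs

atomsIn l (atom q)         = any (q ≡ᵇ_) l
atomsIn l ⊥'               = true
atomsIn l (¬' A)           = atomsIn l A
atomsIn l (A ∧' B)         = atomsIn l A ∧ atomsIn l B
atomsIn l (A ∨' B)         = atomsIn l A ∧ atomsIn l B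
atomsIn l (A ⇒ B)          = atomsIn l A ∧ atomsIn l B
atomsIn l (t ∶ A)          = atomsIn l A
atomsIn l (δ _ _ _ _ _ _ _ Bs) = atomsInV l Bs

atomsInV l []       = true
atomsInV l (B ∷ Bs) = atomsIn l B ∧ atomsInV l Bs

_⇔_ : Fm → Fm → Fm
A ⇔ B = (A ⇒ B) ∧' (B ⇒ A)

sub  : (ℕ → Fm) → Fm → Fm
subV : ∀ {n} → (ℕ → Fm) → Vec Fm n → Vec Fm n
sub σ (atom q)  = σ q
sub σ ⊥'        = ⊥'
sub σ (¬' A)    = ¬' sub σ A
sub σ (A ∧' B)  = sub σ A ∧' sub σ B
sub σ (A ∨' B)  = sub σ A ∨' sub σ B
sub σ (A ⇒ B)   = sub σ A ⇒ sub σ B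
sub σ (t ∶ A)   = t ∶ sub σ A
sub σ (δ n p qs A d g a Bs) = δ n p qs A d g a (subV σ Bs)
subV σ []       = []
subV σ (B ∷ Bs) = sub σ B ∷ subV σ Bs

fpSubst : ∀ {n} → ℕ → Vec ℕ n → Fm → Vec Fm n → ℕ → Fm
fpSubst p qs D Bs r = if r ≡ᵇ p then D else look qs Bs
  where
  look : ∀ {k} → Vec ℕ k → Vec Fm k → Fm
  look []       []       = atom r
  look (q ∷ qs) (B ∷ Bs) = if r ≡ᵇ q then B else look qs Bs

eval : (Fm → Bool) → Fm → Bool
eval v (atom q)  = v (atom q)
eval v ⊥'        = false
eval v (¬' A)    = not (eval v A)
eval v (A ∧' B)  = eval v A ∧ eval v B
eval v (A ∨' B)  = eval v A ∨ eval v B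
eval v (A ⇒ B)   = not (eval v A) ∨ eval v B
eval v (t ∶ A)   = v (t ∶ A)
eval v (δ n p qs A d g a Bs) = v (δ n p qs A d g a Bs)

Tautology : Fm → Set
Tautology A = (v : Fm → Bool) → eval v A ≡ true

data Axiom : Fm → Set where
  taut   : ∀ {A} → Tautology A → Axiom A
  sumL   : ∀ s t A → Axiom ((s ∶ A) ⇒ ((s ⊕ t) ∶ A))
  sumR   : ∀ s t A → Axiom ((s ∶ A) ⇒ ((t ⊕ s) ∶ A))
  appl   : ∀ s t A B → Axiom ((s ∶ (A ⇒ B)) ⇒ ((t ∶ A) ⇒ ((s · t) ∶ B)))
  pos    : ∀ t A → Axiom ((t ∶ A) ⇒ ((! t) ∶ (t ∶ A)))
  fixpt  : ∀ n p qs A d g a Bs →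
           Axiom (δ n p qs A d g a Bs ⇔
                  sub (fpSubst p qs (δ n p qs A d g a Bs) Bs) A)

cnest : List ℕ → Fm → Fm
cnest []       A = A
cnest (c ∷ cs) A = con c ∶ cnest cs A

IsCSFormula : Fm → Set
IsCSFormula F = Σ ℕ λ c → Σ (List ℕ) λ cs → Σ Fm λ A →
                Axiom A × (F ≡ cnest (c ∷ cs) A)

record ConstSpec : Set₁ where
  field
    member   : Fm → Set
    wellForm : ∀ F → member F → IsCSFormula F

data Prf (CS : ConstSpec) : Fm → Set where
  ax  : ∀ {A} → Axiom A → Prf CS A
  mp  : ∀ {A B} → Prf CS (A ⇒ B) → Prf CS A → Prf CS B
  ian : ∀ {F} → ConstSpec.member CS F → Prf CS F

Consistent : ConstSpec → Set
Consistent CS = Prf CS ⊥' → Data.Empty.⊥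

module Submission where

-- Consistency of J4(FP)_CS by a "forgetful" classical semantics.
--
-- Every formula receives a truth value under an assignment ρ of booleans to
-- atoms: connectives are read classically, every justification assertion
-- t:A is read as TRUE, and a fixed-point formula δ_A(B₁,…,Bₙ) is read as the
-- value of its body A(p,q₁,…,qₙ) with qᵢ set to the value of Bᵢ and p set to
-- false.  Because p occurs in A only under some t:, the value of A does not
-- depend on the value given to p (coincidence lemma), so this reading makes
-- δ_A(B⃗) and A(δ_A(B⃗),B⃗) equal (fixed-point lemma, via the substitution
-- lemma).  Since ⊥ is false,
-- it is not derivable: every J4(FP)_CS is consistent.

open import Defs
open import Data.Nat using (ℕ; _≡ᵇ_)
open import Data.Bool using (Bool; true; false; _∧_; _∨_; not; if_then_else_; T)
open import Data.Bool.Properties using (T-∧; T-not-≡)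
open import Data.List using (List; _∷_)
open import Data.Bool.ListAction using (any)
open import Data.Vec using (Vec; []; _∷_; toList)
open import Data.Product using (_,_)
open import Function.Bundles using (Equivalence)
open import Relation.Binary.PropositionalEquality
  using (_≡_; refl; sym; trans; cong; cong₂; subst; module ≡-Reasoning)

open Equivalence using (to)

assign : ∀ {n} → Vec ℕ n → Vec Bool n → ℕ → Bool
assign []       []       r = false
assign (q ∷ qs) (b ∷ bs) r = if r ≡ᵇ q then b else assign qs bs r

fixAssign : ∀ {n} → ℕ → Vec ℕ n → Vec Bool n → ℕ → Bool
fixAssign p qs bs r = if r ≡ᵇ p then false else assign qs bs r

-- The forgetful semantics: justification assertions are true, and δ_A(B⃗)
-- is read through its body A.  Terminates because A is a subterm of δ.
val  : (ℕ → Bool) → Fm → Bool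
vals : ∀ {n} → (ℕ → Bool) → Vec Fm n → Vec Bool n
val ρ (atom q)              = ρ q
val ρ ⊥'                    = false
val ρ (¬' A)                = not (val ρ A)
val ρ (A ∧' B)              = val ρ A ∧ val ρ B
val ρ (A ∨' B)              = val ρ A ∨ val ρ B
val ρ (A ⇒ B)               = not (val ρ A) ∨ val ρ B
val ρ (t ∶ A)               = true
val ρ (δ n p qs A d g a Bs) = val (fixAssign p qs (vals ρ Bs)) A
vals ρ []       = []
vals ρ (B ∷ Bs) = val ρ B ∷ vals ρ Bs

eval-val : ∀ ρ A → eval (val ρ) A ≡ val ρ A
eval-val ρ (atom q)              = refl
eval-val ρ ⊥'                    = refl
eval-val ρ (¬' A)                = cong not (eval-val ρ A)
eval-val ρ (A ∧' B)              = cong₂ _∧_ (eval-val ρ A) (eval-val ρ B)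
eval-val ρ (A ∨' B)              = cong₂ _∨_ (eval-val ρ A) (eval-val ρ B)
eval-val ρ (A ⇒ B)               = cong₂ (λ x y → not x ∨ y) (eval-val ρ A) (eval-val ρ B)
eval-val ρ (t ∶ A)               = refl
eval-val ρ (δ n p qs A d g a Bs) = refl

tautology-valid : ∀ ρ {A} → Tautology A → val ρ A ≡ true
tautology-valid ρ {A} isTaut = trans (sym (eval-val ρ A)) (isTaut (val ρ))

val-sub  : ∀ ρ σ A → val ρ (sub σ A) ≡ val (λ r → val ρ (σ r)) A
vals-sub : ∀ {n} ρ σ (Bs : Vec Fm n) → vals ρ (subV σ Bs) ≡ vals (λ r → val ρ (σ r)) Bs
val-sub ρ σ (atom q)              = refl
val-sub ρ σ ⊥'                    = refl
val-sub ρ σ (¬' A)                = cong not (val-sub ρ σ A)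
val-sub ρ σ (A ∧' B)              = cong₂ _∧_ (val-sub ρ σ A) (val-sub ρ σ B)
val-sub ρ σ (A ∨' B)              = cong₂ _∨_ (val-sub ρ σ A) (val-sub ρ σ B)
val-sub ρ σ (A ⇒ B)               = cong₂ (λ x y → not x ∨ y) (val-sub ρ σ A) (val-sub ρ σ B)
val-sub ρ σ (t ∶ A)               = refl
val-sub ρ σ (δ n p qs A d g a Bs) = cong (λ bs → val (fixAssign p qs bs) A) (vals-sub ρ σ Bs)
vals-sub ρ σ []       = refl
vals-sub ρ σ (B ∷ Bs) = cong₂ _∷_ (val-sub ρ σ B) (vals-sub ρ σ Bs)

AgreeOff : ℕ → List ℕ → (ℕ → Bool) → (ℕ → Bool) → Set
AgreeOff p l ρ ρ' = ∀ r → (r ≡ᵇ p) ≡ false → T (any (r ≡ᵇ_) l) → ρ r ≡ ρ' r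

val-guarded  : ∀ {p l ρ ρ'} A → AgreeOff p l ρ ρ' →
               T (guarded p A) → T (atomsIn l A) → val ρ A ≡ val ρ' A
vals-guarded : ∀ {n p l ρ ρ'} (Bs : Vec Fm n) → AgreeOff p l ρ ρ' →
               T (guardedV p Bs) → T (atomsInV l Bs) → vals ρ Bs ≡ vals ρ' Bs
val-guarded {p} (atom q) agree g a = agree q (to T-not-≡ g) a
val-guarded ⊥'       agree g a = refl
val-guarded (¬' A)   agree g a = cong not (val-guarded A agree g a)
val-guarded (A ∧' B) agree g a with to T-∧ g | to T-∧ a
... | gA , gB | aA , aB = cong₂ _∧_ (val-guarded A agree gA aA) (val-guarded B agree gB aB)
val-guarded (A ∨' B) agree g a with to T-∧ g | to T-∧ a
... | gA , gB | aA , aB = cong₂ _∨_ (val-guarded A agree gA aA) (val-guarded B agree gB aB)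
val-guarded (A ⇒ B)  agree g a with to T-∧ g | to T-∧ a
... | gA , gB | aA , aB =
  cong₂ (λ x y → not x ∨ y) (val-guarded A agree gA aA) (val-guarded B agree gB aB)
val-guarded (t ∶ A)  agree g a = refl
val-guarded (δ n p' qs A d g' a' Bs) agree g a =
  cong (λ bs → val (fixAssign p' qs bs) A) (vals-guarded Bs agree g a)
vals-guarded []       agree g a = refl
vals-guarded (B ∷ Bs) agree g a with to T-∧ g | to T-∧ a
... | gB , gBs | aB , aBs = cong₂ _∷_ (val-guarded B agree gB aB) (vals-guarded Bs agree gBs aBs)

fpSubst-step : ∀ {n} p q (qs : Vec ℕ n) D B Bs r → (r ≡ᵇ p) ≡ false →
               fpSubst p (q ∷ qs) D (B ∷ Bs) r ≡ (if r ≡ᵇ q then B else fpSubst p qs D Bs r)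
fpSubst-step p q qs D B Bs r r≢p rewrite r≢p = refl

val-fpSubst-param : ∀ {n} ρ p (qs : Vec ℕ n) D Bs r → (r ≡ᵇ p) ≡ false →
                    T (any (r ≡ᵇ_) (toList qs)) →
                    val ρ (fpSubst p qs D Bs r) ≡ assign qs (vals ρ Bs) r
val-fpSubst-param ρ p (q ∷ qs) D (B ∷ Bs) r r≢p r∈qs
  rewrite fpSubst-step p q qs D B Bs r r≢p with r ≡ᵇ q
... | true  = refl
... | false = val-fpSubst-param ρ p qs D Bs r r≢p r∈qs

-- The
-- reading assignment of δ and the assignment induced by the substitution
-- agree off p on the atoms p,q⃗ of A, so the coincidence lemma applies.
val-fixpoint : ∀ ρ n p qs A d g a Bs →
  val ρ (δ n p qs A d g a Bs) ≡ val ρ (sub (fpSubst p qs (δ n p qs A d g a Bs) Bs) A)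
val-fixpoint ρ n p qs A d g a Bs = begin
  val (fixAssign p qs (vals ρ Bs)) A  ≡⟨ val-guarded A agree g a ⟩
  val (λ r → val ρ (σ r)) A           ≡⟨ sym (val-sub ρ σ A) ⟩
  val ρ (sub σ A)                     ∎
  where
  open ≡-Reasoning
  σ : ℕ → Fm
  σ = fpSubst p qs (δ n p qs A d g a Bs) Bs
  agree : AgreeOff p (p ∷ toList qs) (fixAssign p qs (vals ρ Bs)) (λ r → val ρ (σ r))
  agree r r≢p r∈pqs = begin
    fixAssign p qs (vals ρ Bs) r  ≡⟨ cong (λ b → if b then false else assign qs (vals ρ Bs) r) r≢p ⟩
    assign qs (vals ρ Bs) r       ≡⟨ sym (val-fpSubst-param ρ p qs _ Bs r r≢p r∈qs) ⟩
    val ρ (σ r)                   ∎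
    where
    r∈qs : T (any (r ≡ᵇ_) (toList qs))
    r∈qs = subst (λ b → T (b ∨ any (r ≡ᵇ_) (toList qs))) r≢p r∈pqs

iff-valid : ∀ x y → x ≡ y → ((not x ∨ y) ∧ (not y ∨ x)) ≡ true
iff-valid false .false refl = refl
iff-valid true  .true  refl = refl

axiom-valid : ∀ ρ {A} → Axiom A → val ρ A ≡ true
axiom-valid ρ (taut {A} t)               = tautology-valid ρ {A} t
axiom-valid ρ (sumL s t A)               = refl
axiom-valid ρ (sumR s t A)               = refl
axiom-valid ρ (appl s t A B)             = refl
axiom-valid ρ (pos t A)                  = refl
axiom-valid ρ (fixpt n p qs A d g a Bs)  = iff-valid _ _ (val-fixpoint ρ n p qs A d g a Bs)

mp-valid : ∀ a b → (not a ∨ b) ≡ true → a ≡ true → b ≡ true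
mp-valid true b a⇒b refl = a⇒b

-- Soundness: everything derivable in J4(FP)_CS is true.  Members of CS have
-- the form c:F and are therefore true.
derivable-valid : ∀ CS ρ {F} → Prf CS F → val ρ F ≡ true
derivable-valid CS ρ (ax axiom)          = axiom-valid ρ axiom
derivable-valid CS ρ (mp {A} {B} p⇒ q)   =
  mp-valid (val ρ A) (val ρ B) (derivable-valid CS ρ p⇒) (derivable-valid CS ρ q)
derivable-valid CS ρ (ian {F} member) with ConstSpec.wellForm CS F member
... | c , cs , A , _ , refl = refl

corollary1 : (CS : ConstSpec) → Consistent CS
corollary1 CS ⊢⊥ with derivable-valid CS (λ _ → false) ⊢⊥
... | ()
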